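{- The tree $K_{1,r}^{+}$ is a $K_r$-amenable graph, and the weak partition $\{V_0,V_1,\ldots,V_r\}$ of $V(K_{1,r}^{+})$ witnessing this is unique up to a permutation of the indices $1,\ldots,r$.
   Context: Let $r$ be an integer with $r\ge 2$. A graph $G$ is called $K_r$-amenable if there exists a weak partition $\{V_0,V_1,\ldots,V_r\}$ of $V(G)$ (a collection of pairwise disjoint, possibly empty, subsets whose union is $V(G)$) such that: (A) if $x\in V_0$, then $|N(x)\cap V_i|=1$ for every $i\in\{1,\ldots,r\}$; (B) the induced subgraph $\langle V_i\rangle$ is a matching (i.e. every vertex of $V_i$ has exactly one neighbor in $V_i$ and $\langle V_i\rangle$ has no other edges) for every $i\in\{1,\ldots,r\}$; (C) the induced subgraph $\langle V_1\cup\cdots\cup V_r\rangle$ is a matching in $G$. The tree $K_{1,r}^{+}$ is the tree of order $2r+1$ obtained from the star $K_{1,r}$ by subdividing each edge exactly once. -}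

module Defs where

open import Data.Nat using (ℕ; suc)
open import Data.Fin using (Fin; zero; suc)
open import Data.Fin.Permutation using (Permutation′; _⟨$⟩ʳ_)
open import Data.Product using (Σ; _×_; _,_)
open import Relation.Binary.PropositionalEquality using (_≡_)
open import Relation.Nullary using (¬_)

ExactlyOne : {V : Set} → (V → Set) → Set
ExactlyOne {V} P = Σ V λ y → P y × (∀ z → P z → z ≡ y)

-- A weak partition {V_0, V_1, ..., V_r} of V is encoded as a labelling
-- f : V → Fin (suc r); label zero means V_0, label (suc i) means V_{i+1}.
-- Parts may be empty.
record IsKrAmenablePartition (r : ℕ) {V : Set} (Adj : V → V → Set)
                             (f : V → Fin (suc r)) : Set where
  field
    condA : ∀ x → f x ≡ zero → ∀ (i : Fin r) →
            ExactlyOne (λ y → Adj x y × f y ≡ suc i)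
    -- (B) ⟨V_i⟩ is a matching: each vertex of V_i has exactly one neighbour in V_i
    condB : ∀ (i : Fin r) x → f x ≡ suc i →
            ExactlyOne (λ y → Adj x y × f y ≡ suc i)
    -- (C) ⟨V_1 ∪ ... ∪ V_r⟩ is a matching
    condC : ∀ x → ¬ (f x ≡ zero) →
            ExactlyOne (λ y → Adj x y × ¬ (f y ≡ zero))

IsKrAmenable : (r : ℕ) {V : Set} (Adj : V → V → Set) → Set
IsKrAmenable r {V} Adj = Σ (V → Fin (suc r)) (IsKrAmenablePartition r Adj)

liftPerm : {r : ℕ} → Permutation′ r → Fin (suc r) → Fin (suc r)
liftPerm σ zero    = zero
liftPerm σ (suc i) = suc (σ ⟨$⟩ʳ i)

-- The tree K_{1,r}^+ : centre c, middle vertices m_i, leaves l_i (i ∈ Fin r);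
-- edges c–m_i and m_i–l_i (subdivided star).
data KV (r : ℕ) : Set where
  centre : KV r
  mid    : Fin r → KV r
  leaf   : Fin r → KV r

data KAdj {r : ℕ} : KV r → KV r → Set where
  c-m : ∀ i → KAdj centre (mid i)
  m-c : ∀ i → KAdj (mid i) centre
  m-l : ∀ i → KAdj (mid i) (leaf i)
  l-m : ∀ i → KAdj (leaf i) (mid i)

module Submission where

-- For uniqueness we show that every K_r-amenable partition f (with r ≥ 2) is a
-- relabelling of the canonical one: f = liftPerm π ∘ canonical for some
-- permutation π of the indices.  The argument, given two distinct indices:
--   * a leaf is not in V₀, since by (A) its single neighbour m_j would lie in
--     two different parts;  by (B) m_j then lies in the same part as l_j;
--   * the centre is in V₀, since otherwise by (C) it would have a unique
--     neighbour outside V₀, but all the m_j are outside V₀;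
--   * by (A) at the centre, each part V_{i+1} contains exactly one m_j, so
--     j ↦ (index of the part of m_j) is a bijection π.
-- Two amenable partitions f = π_f ∘ canonical and g = π_g ∘ canonical then
-- differ by the relabelling π_f⁻¹ followed by π_g.

open import Defs
open import Data.Nat using (ℕ; _≤_; s≤s; z≤n)
open import Data.Nat as ℕ using ()
open import Data.Fin using (Fin; zero; suc)
open import Data.Fin.Properties using (suc-injective; 0≢1+n)
open import Data.Fin.Permutation
  using (Permutation′; permutation; inverseˡ; flip; _∘ₚ_)
open import Data.Product using (Σ; _×_; _,_; proj₁; proj₂)
open import Relation.Binary.PropositionalEquality
  using (_≡_; _≢_; refl; sym; trans; cong; module ≡-Reasoning)
open import Relation.Nullary using (¬_)
open import Data.Empty using (⊥-elim)
open import Function using (_∘_)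

exactlyOne-unique : ∀ {V : Set} {P : V → Set} → ExactlyOne P →
                    ∀ {a b} → P a → P b → a ≡ b
exactlyOne-unique (_ , _ , only) pa pb = trans (only _ pa) (sym (only _ pb))

nonzero⇒suc : ∀ {n} (k : Fin (ℕ.suc n)) → k ≢ zero → Σ (Fin n) λ i → k ≡ suc i
nonzero⇒suc zero    k≢0 = ⊥-elim (k≢0 refl)
nonzero⇒suc (suc i) _   = i , refl

mid-injective : ∀ {r} {i j : Fin r} → _≡_ {A = KV r} (mid i) (mid j) → i ≡ j
mid-injective refl = refl

liftPerm-∘ : ∀ {r} (π σ : Permutation′ r) (k : Fin (ℕ.suc r)) →
             liftPerm (π ∘ₚ σ) k ≡ liftPerm σ (liftPerm π k)
liftPerm-∘ π σ zero    = refl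
liftPerm-∘ π σ (suc i) = refl

liftPerm-inverse : ∀ {r} (π : Permutation′ r) (k : Fin (ℕ.suc r)) →
                   liftPerm (flip π) (liftPerm π k) ≡ k
liftPerm-inverse π zero    = refl
liftPerm-inverse π (suc i) = cong suc (inverseˡ π)

canonical : ∀ {r} → KV r → Fin (ℕ.suc r)
canonical centre   = zero
canonical (mid j)  = suc j
canonical (leaf j) = suc j

canonical-amenable : ∀ r → IsKrAmenablePartition r (KAdj {r}) canonical
canonical-amenable r = record { condA = condA ; condB = condB ; condC = condC }
  where
  condA : ∀ x → canonical x ≡ zero → ∀ i →
          ExactlyOne (λ y → KAdj x y × canonical y ≡ suc i)
  condA centre _ i = mid i , (c-m i , refl) , λ { .(mid _) (c-m _ , refl) → refl }
  condA (mid _)  ()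
  condA (leaf _) ()

  condB : ∀ i x → canonical x ≡ suc i →
          ExactlyOne (λ y → KAdj x y × canonical y ≡ suc i)
  condB i centre ()
  condB i (mid .i) refl =
    leaf i , (m-l i , refl) , λ { .centre (m-c _ , ()) ; .(leaf _) (m-l _ , _) → refl }
  condB i (leaf .i) refl = mid i , (l-m i , refl) , λ { .(mid _) (l-m _ , _) → refl }

  condC : ∀ x → ¬ (canonical x ≡ zero) →
          ExactlyOne (λ y → KAdj x y × ¬ (canonical y ≡ zero))
  condC centre c∉V₀ = ⊥-elim (c∉V₀ refl)
  condC (mid i) _ =
    leaf i , (m-l i , λ ()) ,
    λ { .centre (m-c _ , c∉V₀) → ⊥-elim (c∉V₀ refl) ; .(leaf _) (m-l _ , _) → refl }
  condC (leaf i) _ = mid i , (l-m i , λ ()) , λ { .(mid _) (l-m _ , _) → refl }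

module PartitionShape {r} (f : KV r → Fin (ℕ.suc r))
                      (P : IsKrAmenablePartition r (KAdj {r}) f)
                      (i₀ i₁ : Fin r) (i₀≢i₁ : i₀ ≢ i₁) where
  open IsKrAmenablePartition P

  -- The only neighbour m_j of a leaf cannot lie in both V_{i₀+1} and V_{i₁+1}.
  leaf∉V₀ : ∀ j → f (leaf j) ≢ zero
  leaf∉V₀ j l∈V₀ with condA (leaf j) l∈V₀ i₀ | condA (leaf j) l∈V₀ i₁
  ... | .(mid j) , (l-m .j , m∈V₀) , _ | .(mid j) , (l-m .j , m∈V₁) , _ =
    i₀≢i₁ (suc-injective (trans (sym m∈V₀) m∈V₁))

  -- By (B), the matching partner of l_j inside its part is m_j.
  mid≡leaf : ∀ j → f (mid j) ≡ f (leaf j)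
  mid≡leaf j with nonzero⇒suc (f (leaf j)) (leaf∉V₀ j)
  ... | i , l∈Vᵢ with condB i (leaf j) l∈Vᵢ
  ...   | .(mid j) , (l-m .j , m∈Vᵢ) , _ = trans m∈Vᵢ (sym l∈Vᵢ)

  -- m_j shares the part of l_j, so it is not in V₀ either.
  mid∉V₀ : ∀ j → f (mid j) ≢ zero
  mid∉V₀ j m∈V₀ = leaf∉V₀ j (trans (sym (mid≡leaf j)) m∈V₀)

  -- Otherwise, by (C), m_{i₀} and m_{i₁} would both be the centre's unique
  -- neighbour outside V₀.
  centre∈V₀ : f centre ≡ zero
  centre∈V₀ with f centre in eq
  ... | zero  = refl
  ... | suc _ = ⊥-elim (i₀≢i₁ (mid-injective
    (exactlyOne-unique (condC centre c∉V₀) (c-m i₀ , mid∉V₀ i₀) (c-m i₁ , mid∉V₀ i₁))))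
    where
    c∉V₀ : f centre ≢ zero
    c∉V₀ c∈V₀ = 0≢1+n (trans (sym c∈V₀) eq)

  partOf : Fin r → Fin r
  partOf j = proj₁ (nonzero⇒suc (f (mid j)) (mid∉V₀ j))

  mid∈partOf : ∀ j → f (mid j) ≡ suc (partOf j)
  mid∈partOf j = proj₂ (nonzero⇒suc (f (mid j)) (mid∉V₀ j))

  -- By (A) at the centre, V_{i+1} contains exactly one middle vertex, m_{memberOf i}.
  memberOf : Fin r → Fin r
  memberOf i with condA centre centre∈V₀ i
  ... | .(mid j) , (c-m j , _) , _ = j

  memberOf∈ : ∀ i → f (mid (memberOf i)) ≡ suc i
  memberOf∈ i with condA centre centre∈V₀ i
  ... | .(mid j) , (c-m j , m∈Vᵢ) , _ = m∈Vᵢ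

  memberOf-unique : ∀ {i j} → f (mid j) ≡ suc i → memberOf i ≡ j
  memberOf-unique {i} {j} m∈Vᵢ = mid-injective
    (exactlyOne-unique (condA centre centre∈V₀ i)
      (c-m (memberOf i) , memberOf∈ i) (c-m j , m∈Vᵢ))

  π : Permutation′ r
  π = permutation partOf memberOf
        (λ i → suc-injective (trans (sym (mid∈partOf (memberOf i))) (memberOf∈ i)))
        (λ j → memberOf-unique (mid∈partOf j))

  π⁻¹ : Permutation′ r
  π⁻¹ = flip π

  relabelling : ∀ x → f x ≡ liftPerm π (canonical x)
  relabelling centre   = centre∈V₀
  relabelling (mid j)  = mid∈partOf j
  relabelling (leaf j) = trans (sym (mid≡leaf j)) (mid∈partOf j)

partitions-related : ∀ {r} (i₀ i₁ : Fin r) → i₀ ≢ i₁ → ∀ f g →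
  IsKrAmenablePartition r (KAdj {r}) f → IsKrAmenablePartition r (KAdj {r}) g →
  Σ (Permutation′ r) λ σ → ∀ (x : KV r) → g x ≡ liftPerm σ (f x)
partitions-related i₀ i₁ i₀≢i₁ f g Pf Pg = F.π⁻¹ ∘ₚ G.π , related
  where
  module F = PartitionShape f Pf i₀ i₁ i₀≢i₁
  module G = PartitionShape g Pg i₀ i₁ i₀≢i₁
  open ≡-Reasoning

  related : ∀ x → g x ≡ liftPerm (F.π⁻¹ ∘ₚ G.π) (f x)
  related x = begin
    g x                                       ≡⟨ G.relabelling x ⟩
    liftPerm G.π (canonical x)                ≡⟨ cong (liftPerm G.π) (sym (liftPerm-inverse F.π _)) ⟩
    liftPerm G.π (liftPerm F.π⁻¹ (liftPerm F.π (canonical x)))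
                                              ≡⟨ cong (liftPerm G.π ∘ liftPerm F.π⁻¹) (sym (F.relabelling x)) ⟩
    liftPerm G.π (liftPerm F.π⁻¹ (f x))       ≡⟨ sym (liftPerm-∘ F.π⁻¹ G.π (f x)) ⟩
    liftPerm (F.π⁻¹ ∘ₚ G.π) (f x)             ∎

-- For r ≥ 2 the indices 0 and 1 are distinct, so the shape analysis applies.
mainTheorem3 : (r : ℕ) → 2 ≤ r →
    IsKrAmenable r (KAdj {r})
    × (∀ f g → IsKrAmenablePartition r (KAdj {r}) f → IsKrAmenablePartition r (KAdj {r}) g →
       Σ (Permutation′ r) λ σ → ∀ (x : KV r) → g x ≡ liftPerm σ (f x))
mainTheorem3 (ℕ.suc (ℕ.suc n)) (s≤s (s≤s z≤n)) =
  (canonical , canonical-amenable _) , partitions-related zero (suc zero) (λ ())
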